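{- $\gamma^{L\text{ - }LD}(\mathcal{K})=\frac{3}{16}$.
   Context: The king grid $\mathcal{K}$ has vertex set $\mathbb{Z}^2$, with $\mathbf{u},\mathbf{v}$ adjacent iff $\mathbf{u}-\mathbf{v}\in\{(\pm1,0),(0,\pm1),(\pm1,\pm1)\}$. For a vertex $u$, $N[u]$ is its closed neighbourhood; for a code (nonempty vertex subset) $C$, $I_C(u)=N[u]\cap C$. $C$ is a covering code if $I_C(u)\neq\emptyset$ for all $u$, and a local locating-dominating code if it is covering and $I_C(u)\neq I_C(v)$ for all adjacent $u,v\notin C$. The density of $C\subseteq\mathbb{Z}^2$ is $D(C)=\limsup_{n\to\infty}\frac{|C\cap Q_n|}{|Q_n|}$ with $Q_n=\{(i,j)\in\mathbb{Z}^2: |i|\leq n,|j|\leq n\}$. $\gamma^{L\text{ - }LD}(\mathcal{K})$ is the smallest density of a local locating-dominating code in $\mathcal{K}$. -}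

module Defs where

open import Data.Bool using (Bool; true; false; if_then_else_)
open import Data.Nat as ℕ using (ℕ; zero; suc)
open import Data.Integer as ℤ using (ℤ; +_; ∣_∣)
open import Data.Rational as ℚ using (ℚ; _/_)
open import Data.List using (List; map; upTo)
open import Data.Nat.ListAction using (sum)
open import Data.Product using (_×_; _,_; Σ; ∃; ∃-syntax)
open import Relation.Binary.PropositionalEquality using (_≡_; _≢_)
open import Relation.Nullary using (¬_)

Vertex : Set
Vertex = ℤ × ℤ

Code : Set
Code = Vertex → Bool

_∈C_ : Vertex → Code → Set
v ∈C C = C v ≡ true

InN : Vertex → Vertex → Set
InN (ux , uy) (wx , wy) = (∣ ux ℤ.- wx ∣ ℕ.≤ 1) × (∣ uy ℤ.- wy ∣ ℕ.≤ 1)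

Adjacent : Vertex → Vertex → Set
Adjacent u v = InN u v × (u ≢ v)

InI : Code → Vertex → Vertex → Set
InI C u w = InN u w × (w ∈C C)

SameI : Code → Vertex → Vertex → Set
SameI C u v = ∀ w → (InI C u w → InI C v w) × (InI C v w → InI C u w)

Nonempty : Code → Set
Nonempty C = ∃[ v ] (v ∈C C)

Covering : Code → Set
Covering C = ∀ u → ∃[ w ] InI C u w

LocalLD : Code → Set
LocalLD C = Nonempty C × Covering C ×
  (∀ u v → Adjacent u v → ¬ (u ∈C C) → ¬ (v ∈C C) → ¬ SameI C u v)

range : ℕ → List ℤ
range n = map (λ k → + k ℤ.- + n) (upTo (suc (2 ℕ.* n)))

count : Code → ℕ → ℕ
count C n = sum (map (λ i → sum (map (λ j → if C (i , j) then 1 else 0) (range n))) (range n))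

-- |Q_n| = (2n+1)^2 = 4n^2 + 4n + 1
sizeQ : ℕ → ℕ
sizeQ n = suc (4 ℕ.* n ℕ.* n ℕ.+ 4 ℕ.* n)

ratio : Code → ℕ → ℚ
ratio C n = (+ count C n) / sizeQ n

-- D(C) ≤ q, with D(C) = limsup ratio
DensityLe : Code → ℚ → Set
DensityLe C q = ∀ (ε : ℚ) → ℚ.Positive ε →
  ∃[ N ] (∀ n → N ℕ.≤ n → ratio C n ℚ.< q ℚ.+ ε)

-- D(C) ≥ q, with D(C) = limsup ratio
DensityGe : Code → ℚ → Set
DensityGe C q = ∀ (ε : ℚ) → ℚ.Positive ε →
  ∀ N → ∃[ n ] (N ℕ.≤ n × q ℚ.- ε ℚ.< ratio C n)

{-# OPTIONS --safe #-}
-- Being local locating-dominating is a property of 4 × 4 windows: a nonempty code is one iff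
-- in every window the four central vertices are covered and every two of them that are not
-- codewords are separated, and these conditions involve only the sixteen cells of the window.
--
-- Lower bound: an exhaustive search over the 2^16 fillings of a window shows that the
-- conditions force at least three codewords, and tiling Q_n by windows gives density ≥ 3/16.
--
-- Upper bound: repeat the 4 × 8 tile with codewords (1,2), (1,5), (1,7), (3,1), (3,3), (3,6).
-- Every 4 × 8 rectangle then contains six codewords, and every window is a translate of one
-- of the 32 windows of the torus, which are checked directly.
module Submission where

open import Defs
open import Data.Product using (_×_; _,_; ∃-syntax)

module FiniteSums where
  open import Data.Nat
  open import Data.Nat.Properties
  open import Data.Nat.DivMod using (_/_; _%_; m≡m%n+[m/n]*n; m%n<n; m/n*n≤m)
  open import Data.Nat.ListAction using (sum)
  open import Algebra.Properties.CommutativeSemigroup +-commutativeSemigroup using (interchange)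
  open import Data.List using (map; applyUpTo)
  open import Relation.Binary.PropositionalEquality

  sumBelow : ℕ → (ℕ → ℕ) → ℕ
  sumBelow zero    f = 0
  sumBelow (suc n) f = f 0 + sumBelow n (λ k → f (suc k))

  sumBelow-cong : ∀ n {f g} → (∀ k → f k ≡ g k) → sumBelow n f ≡ sumBelow n g
  sumBelow-cong zero    f≗g = refl
  sumBelow-cong (suc n) f≗g = cong₂ _+_ (f≗g 0) (sumBelow-cong n (λ k → f≗g (suc k)))

  sumBelow-monoʳ-≤ : ∀ n {f g} → (∀ k → f k ≤ g k) → sumBelow n f ≤ sumBelow n g
  sumBelow-monoʳ-≤ zero    f≤g = z≤n
  sumBelow-monoʳ-≤ (suc n) f≤g = +-mono-≤ (f≤g 0) (sumBelow-monoʳ-≤ n (λ k → f≤g (suc k)))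

  sumBelow-const : ∀ n c → sumBelow n (λ _ → c) ≡ n * c
  sumBelow-const zero    c = refl
  sumBelow-const (suc n) c = cong (c +_) (sumBelow-const n c)

  sumBelow²-const : ∀ m k c → sumBelow m (λ _ → sumBelow k (λ _ → c)) ≡ m * (k * c)
  sumBelow²-const m k c = trans (sumBelow-const m _) (cong (m *_) (sumBelow-const k c))

  sumBelow-+ : ∀ m n f → sumBelow (m + n) f ≡ sumBelow m f + sumBelow n (λ k → f (m + k))
  sumBelow-+ zero    n f = refl
  sumBelow-+ (suc m) n f = begin
    f 0 + sumBelow (m + n) (λ k → f (suc k))
      ≡⟨ cong (f 0 +_) (sumBelow-+ m n (λ k → f (suc k))) ⟩
    f 0 + (sumBelow m (λ k → f (suc k)) + sumBelow n (λ k → f (suc m + k)))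
      ≡⟨ +-assoc (f 0) _ _ ⟨
    f 0 + sumBelow m (λ k → f (suc k)) + sumBelow n (λ k → f (suc m + k)) ∎
    where open ≡-Reasoning

  sumBelow-monoˡ-≤ : ∀ {m n} f → m ≤ n → sumBelow m f ≤ sumBelow n f
  sumBelow-monoˡ-≤ {m} {n} f m≤n = begin
    sumBelow m f                                        ≤⟨ m≤m+n _ _ ⟩
    sumBelow m f + sumBelow (n ∸ m) (λ k → f (m + k))  ≡⟨ sumBelow-+ m (n ∸ m) f ⟨
    sumBelow (m + (n ∸ m)) f                            ≡⟨ cong (λ l → sumBelow l f) (m+[n∸m]≡n m≤n) ⟩
    sumBelow n f                                        ∎
    where open ≤-Reasoning

  sumBelow-distrib : ∀ n f g → sumBelow n (λ k → f k + g k) ≡ sumBelow n f + sumBelow n g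
  sumBelow-distrib zero    f g = refl
  sumBelow-distrib (suc n) f g = begin
    f 0 + g 0 + sumBelow n (λ k → f (suc k) + g (suc k))
      ≡⟨ cong (f 0 + g 0 +_) (sumBelow-distrib n (λ k → f (suc k)) (λ k → g (suc k))) ⟩
    f 0 + g 0 + (sumBelow n (λ k → f (suc k)) + sumBelow n (λ k → g (suc k)))
      ≡⟨ interchange (f 0) (g 0) _ _ ⟩
    f 0 + sumBelow n (λ k → f (suc k)) + (g 0 + sumBelow n (λ k → g (suc k))) ∎
    where open ≡-Reasoning

  sumBelow-comm : ∀ m n (f : ℕ → ℕ → ℕ) →
    sumBelow m (λ i → sumBelow n (f i)) ≡ sumBelow n (λ j → sumBelow m (λ i → f i j))
  sumBelow-comm zero    n f = sym (trans (sumBelow-const n 0) (*-zeroʳ n))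
  sumBelow-comm (suc m) n f = begin
    sumBelow n (f 0) + sumBelow m (λ i → sumBelow n (f (suc i)))
      ≡⟨ cong (sumBelow n (f 0) +_) (sumBelow-comm m n (λ i → f (suc i))) ⟩
    sumBelow n (f 0) + sumBelow n (λ j → sumBelow m (λ i → f (suc i) j))
      ≡⟨ sumBelow-distrib n (f 0) _ ⟨
    sumBelow n (λ j → sumBelow (suc m) (λ i → f i j)) ∎
    where open ≡-Reasoning

  sumBelow-blocks : ∀ m w f →
    sumBelow (m * w) f ≡ sumBelow m (λ s → sumBelow w (λ k → f (s * w + k)))
  sumBelow-blocks zero    w f = refl
  sumBelow-blocks (suc m) w f = begin
    sumBelow (w + m * w) f
      ≡⟨ sumBelow-+ w (m * w) f ⟩
    sumBelow w f + sumBelow (m * w) (λ k → f (w + k))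
      ≡⟨ cong (sumBelow w f +_) (sumBelow-blocks m w (λ k → f (w + k))) ⟩
    sumBelow w f + sumBelow m (λ s → sumBelow w (λ k → f (w + (s * w + k))))
      ≡⟨ cong (sumBelow w f +_) (sumBelow-cong m λ s → sumBelow-cong w λ k →
           cong f (+-assoc w (s * w) k)) ⟨
    sumBelow (suc m) (λ s → sumBelow w (λ k → f (s * w + k))) ∎
    where open ≡-Reasoning

  sum-map-applyUpTo : ∀ n (f : ℕ → ℕ) {A : Set} (g : ℕ → A) (h : A → ℕ) →
    sum (map h (map g (applyUpTo f n))) ≡ sumBelow n (λ k → h (g (f k)))
  sum-map-applyUpTo zero    f g h = refl
  sum-map-applyUpTo (suc n) f g h =
    cong (h (g (f 0)) +_) (sum-map-applyUpTo n (λ k → f (suc k)) g h)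

  rectSum : (ℕ → ℕ → ℕ) → ℕ → ℕ → ℕ
  rectSum G h w = sumBelow h (λ i → sumBelow w (G i))

  blockSum : (ℕ → ℕ → ℕ) → ℕ → ℕ → ℕ → ℕ → ℕ
  blockSum G a b h w = rectSum (λ i j → G (a + i) (b + j)) h w

  rectSum-cong : ∀ h w {G G′} → (∀ i j → G i j ≡ G′ i j) → rectSum G h w ≡ rectSum G′ h w
  rectSum-cong h w G≗G′ = sumBelow-cong h (λ i → sumBelow-cong w (G≗G′ i))

  rectSum-mono-≤ : ∀ G {h h′ w w′} → h ≤ h′ → w ≤ w′ → rectSum G h w ≤ rectSum G h′ w′
  rectSum-mono-≤ G {h} h≤h′ w≤w′ = ≤-trans
    (sumBelow-monoʳ-≤ h (λ i → sumBelow-monoˡ-≤ (G i) w≤w′))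
    (sumBelow-monoˡ-≤ _ h≤h′)

  rectSum-tiles : ∀ G m h k w → rectSum G (m * h) (k * w) ≡
    sumBelow m (λ s → sumBelow k (λ t → blockSum G (s * h) (t * w) h w))
  rectSum-tiles G m h k w = begin
    sumBelow (m * h) (λ i → sumBelow (k * w) (G i))
      ≡⟨ sumBelow-blocks m h _ ⟩
    sumBelow m (λ s → sumBelow h (λ i → sumBelow (k * w) (G (s * h + i))))
      ≡⟨ sumBelow-cong m (λ s → sumBelow-cong h (λ i → sumBelow-blocks k w _)) ⟩
    sumBelow m (λ s → sumBelow h (λ i → sumBelow k (λ t →
      sumBelow w (λ j → G (s * h + i) (t * w + j)))))
      ≡⟨ sumBelow-cong m (λ s → sumBelow-comm h k _) ⟩
    sumBelow m (λ s → sumBelow k (λ t → blockSum G (s * h) (t * w) h w)) ∎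
    where open ≡-Reasoning

  tiles-≥ : ∀ G {h w c} → (∀ a b → c ≤ blockSum G a b h w) →
    ∀ m k → m * (k * c) ≤ rectSum G (m * h) (k * w)
  tiles-≥ G {h} {w} {c} c≤ m k = begin
    m * (k * c)
      ≡⟨ sumBelow²-const m k c ⟨
    sumBelow m (λ _ → sumBelow k (λ _ → c))
      ≤⟨ sumBelow-monoʳ-≤ m (λ s → sumBelow-monoʳ-≤ k (λ t → c≤ (s * h) (t * w))) ⟩
    sumBelow m (λ s → sumBelow k (λ t → blockSum G (s * h) (t * w) h w))
      ≡⟨ rectSum-tiles G m h k w ⟨
    rectSum G (m * h) (k * w) ∎
    where open ≤-Reasoning

  tiles-≤ : ∀ G {h w c} → (∀ a b → blockSum G a b h w ≤ c) →
    ∀ m k → rectSum G (m * h) (k * w) ≤ m * (k * c)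
  tiles-≤ G {h} {w} {c} ≤c m k = begin
    rectSum G (m * h) (k * w)
      ≡⟨ rectSum-tiles G m h k w ⟩
    sumBelow m (λ s → sumBelow k (λ t → blockSum G (s * h) (t * w) h w))
      ≤⟨ sumBelow-monoʳ-≤ m (λ s → sumBelow-monoʳ-≤ k (λ t → ≤c (s * h) (t * w))) ⟩
    sumBelow m (λ _ → sumBelow k (λ _ → c))
      ≡⟨ sumBelow²-const m k c ⟩
    m * (k * c) ∎
    where open ≤-Reasoning

  covering-multiple : ∀ L w → ∃[ m ] (L ≤ m * suc w × m * suc w ≤ L + w)
  covering-multiple L w = q , L≤q*[1+w] , m/n*n≤m (L + w) (suc w)
    where
    q = (L + w) / suc w
    L≤q*[1+w] : L ≤ q * suc w
    L≤q*[1+w] = +-cancelʳ-≤ w L _ (begin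
      L + w                        ≡⟨ m≡m%n+[m/n]*n (L + w) (suc w) ⟩
      (L + w) % suc w + q * suc w  ≤⟨ +-monoˡ-≤ _ (≤-pred (m%n<n (L + w) (suc w))) ⟩
      w + q * suc w                ≡⟨ +-comm w _ ⟩
      q * suc w + w                ∎)
      where open ≤-Reasoning

module Windows where
  open import Data.Bool using (Bool; true; false; T; not; _∧_; _∨_; if_then_else_)
  open import Data.Bool.Properties using (T-∧; T-≡)
  open import Data.Bool.ListAction using (any; all)
  open import Data.Empty using (⊥; ⊥-elim)
  open import Data.Nat as ℕ using (ℕ; zero; suc; _≤_; _≤ᵇ_; s≤s)
  import Data.Nat.Properties as ℕP
  open import Data.Integer using (+_; -[1+_]; _+_; _-_; _⊖_; ∣_∣)
  import Data.Integer.Properties as ℤP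
  open import Data.Integer.Tactic.RingSolver using (solve-∀)
  open import Algebra.Bundles using (AbelianGroup)
  open import Algebra.Properties.Group (AbelianGroup.group ℤP.+-0-abelianGroup) using (∙-cancelʳ)
  open import Data.List using (List; []; _∷_; cartesianProduct)
  open import Data.List.Membership.Propositional using (_∈_; find; lose)
  open import Data.List.Membership.Propositional.Properties
    using (∈-map⁺; ∈-cartesianProduct⁺; ∈-cartesianProduct⁻)
  open import Data.List.Relation.Unary.Any using (here; there)
  import Data.List.Relation.Unary.All as All
  open import Data.List.Relation.Unary.Any.Properties using (any⁺; any⁻)
  open import Data.List.Relation.Unary.All.Properties using (all⁺; all⁻)
  open import Data.Vec using (Vec; []; _∷_)
  import Data.Vec as Vec
  import Data.Vec.Properties as Vec
  open import Data.Fin.Subset using (Subset)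
  open import Data.Fin.Subset.Properties using (anySubset?)
  open import Data.Product using (proj₁; proj₂)
  open import Data.Product.Properties using (≡-dec)
  open import Data.Product.Function.NonDependent.Propositional using (_×-⇔_)
  open import Function using (_⇔_; mk⇔; Equivalence; _∘_)
  open import Function.Construct.Composition using (_⇔-∘_)
  open import Relation.Binary.PropositionalEquality
  open import Relation.Nullary using (¬_; Dec; does; yes; no)
  open import Relation.Nullary.Decidable using (toWitnessFalse; T?; _×-dec_)
  open Equivalence using (to; from)
  open FiniteSums

  Cell : Set
  Cell = ℕ × ℕ

  Window : Set
  Window = Cell → Bool

  at : Vertex → Cell → Vertex
  at (a , b) (i , j) = (+ i + a , + j + b)

  window : Code → Vertex → Window
  window C o c = C (at o c)

  at-injective : ∀ o {c c′} → at o c ≡ at o c′ → c ≡ c′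
  at-injective (a , b) eq = cong₂ _,_
    (ℤP.+-injective (∙-cancelʳ a _ _ (cong proj₁ eq)))
    (ℤP.+-injective (∙-cancelʳ b _ _ (cong proj₂ eq)))

  ∣m⊖n∣≡∣m-n∣ : ∀ m n → ∣ m ⊖ n ∣ ≡ ℕ.∣ m - n ∣
  ∣m⊖n∣≡∣m-n∣ zero    zero    = refl
  ∣m⊖n∣≡∣m-n∣ zero    (suc n) = refl
  ∣m⊖n∣≡∣m-n∣ (suc m) zero    = refl
  ∣m⊖n∣≡∣m-n∣ (suc m) (suc n) =
    trans (cong ∣_∣ (ℤP.[1+m]⊖[1+n]≡m⊖n m n)) (∣m⊖n∣≡∣m-n∣ m n)

  ∣[i+a]-[j+a]∣≡∣i-j∣ : ∀ a i j → ∣ (+ i + a) - (+ j + a) ∣ ≡ ℕ.∣ i - j ∣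
  ∣[i+a]-[j+a]∣≡∣i-j∣ a i j = begin
    ∣ (+ i + a) - (+ j + a) ∣  ≡⟨ cong ∣_∣ (shift-invariant (+ i) (+ j) a) ⟩
    ∣ + i - + j ∣              ≡⟨ cong ∣_∣ (ℤP.m-n≡m⊖n i j) ⟩
    ∣ i ⊖ j ∣                  ≡⟨ ∣m⊖n∣≡∣m-n∣ i j ⟩
    ℕ.∣ i - j ∣                ∎
    where
    open ≡-Reasoning
    shift-invariant : ∀ x y a → (x + a) - (y + a) ≡ x - y
    shift-invariant = solve-∀

  near : Cell → Cell → Bool
  near (i , j) (i′ , j′) = (ℕ.∣ i - i′ ∣ ≤ᵇ 1) ∧ (ℕ.∣ j - j′ ∣ ≤ᵇ 1)

  near⇔InN : ∀ o c c′ → T (near c c′) ⇔ InN (at o c) (at o c′)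
  near⇔InN (a , b) (i , j) (i′ , j′) = (close⇔ a i i′ ×-⇔ close⇔ b j j′) ⇔-∘ T-∧
    where
    close⇔ : ∀ a i i′ → T (ℕ.∣ i - i′ ∣ ≤ᵇ 1) ⇔ (∣ (+ i + a) - (+ i′ + a) ∣ ≤ 1)
    close⇔ a i i′ = mk⇔
      (subst (_≤ 1) (sym (∣[i+a]-[j+a]∣≡∣i-j∣ a i i′)) ∘ ℕP.≤ᵇ⇒≤ _ 1)
      (ℕP.≤⇒≤ᵇ ∘ subst (_≤ 1) (∣[i+a]-[j+a]∣≡∣i-j∣ a i i′))

  line : ℕ → List ℕ
  line p = p ∷ suc p ∷ suc (suc p) ∷ []

  centre : Cell → Cell
  centre (p , q) = suc p , suc q

  -- The closed neighbourhood of centre z; indexing by the lower corner z keeps all cells in ℕ².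
  ball : Cell → List Cell
  ball (p , q) = cartesianProduct (line p) (line q)

  ∈line⇒near : ∀ p {k} → k ∈ line p → T (ℕ.∣ suc p - k ∣ ≤ᵇ 1)
  ∈line⇒near zero    (here refl)                 = _
  ∈line⇒near zero    (there (here refl))         = _
  ∈line⇒near zero    (there (there (here refl))) = _
  ∈line⇒near (suc p) (here refl)                 = ∈line⇒near p (here refl)
  ∈line⇒near (suc p) (there (here refl))         = ∈line⇒near p (there (here refl))
  ∈line⇒near (suc p) (there (there (here refl))) = ∈line⇒near p (there (there (here refl)))

  near⇒∈line : ∀ p k → T (ℕ.∣ suc p - k ∣ ≤ᵇ 1) → k ∈ line p
  near⇒∈line zero    0       _ = here refl
  near⇒∈line zero    1       _ = there (here refl)
  near⇒∈line zero    2       _ = there (there (here refl))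
  near⇒∈line (suc p) (suc k) h = ∈-map⁺ suc (near⇒∈line p k h)

  ∈ball⇔near : ∀ z c → c ∈ ball z ⇔ T (near (centre z) c)
  ∈ball⇔near (p , q) (k , l) = mk⇔
    (λ c∈ → let k∈ , l∈ = ∈-cartesianProduct⁻ (line p) (line q) c∈
            in from T-∧ (∈line⇒near p k∈ , ∈line⇒near q l∈))
    (λ h → let hk , hl = to T-∧ h
           in ∈-cartesianProduct⁺ (near⇒∈line p k hk) (near⇒∈line q l hl))

  near-suc⇒nonneg : ∀ p y → ∣ + suc p - y ∣ ≤ 1 → ∃[ k ] y ≡ + k
  near-suc⇒nonneg p (+ k)    _       = k , refl
  near-suc⇒nonneg p -[1+ n ] (s≤s h) with () ← ℕP.m+n≤o⇒n≤o p h

  offset-of-near : ∀ p a x → ∣ (+ suc p + a) - x ∣ ≤ 1 → ∃[ k ] x ≡ + k + a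
  offset-of-near p a x h =
    let k , x-a≡k = near-suc⇒nonneg p (x - a) (subst (λ d → ∣ d ∣ ≤ 1) (rearrange (+ suc p) a x) h)
    in k , trans (restore x a) (cong (_+ a) x-a≡k)
    where
    rearrange : ∀ s a x → (s + a) - x ≡ s - (x - a)
    rearrange = solve-∀
    restore : ∀ x a → x ≡ (x - a) + a
    restore = solve-∀

  ball-complete : ∀ o z w → InN (at o (centre z)) w → ∃[ c ] (c ∈ ball z × w ≡ at o c)
  ball-complete o@(a , b) z@(p , q) (x , y) inN@(hx , hy)
    with k , refl ← offset-of-near p a x hx | l , refl ← offset-of-near q b y hy
    = (k , l) , from (∈ball⇔near z (k , l)) (from (near⇔InN o (centre z) (k , l)) inN) , refl

  bits : List ℕ
  bits = 0 ∷ 1 ∷ []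

  innerCorners : List Cell
  innerCorners = cartesianProduct bits bits

  bits-near : ∀ {i j} → i ∈ bits → j ∈ bits → T (ℕ.∣ suc i - suc j ∣ ≤ᵇ 1)
  bits-near (here refl)         (here refl)         = _
  bits-near (here refl)         (there (here refl)) = _
  bits-near (there (here refl)) (here refl)         = _
  bits-near (there (here refl)) (there (here refl)) = _

  innerCorners-near : ∀ {z z′} → z ∈ innerCorners → z′ ∈ innerCorners →
    T (near (centre z) (centre z′))
  innerCorners-near z∈ z′∈ =
    let i∈ , i′∈ = ∈-cartesianProduct⁻ bits bits z∈
        j∈ , j′∈ = ∈-cartesianProduct⁻ bits bits z′∈
    in from T-∧ (bits-near i∈ j∈ , bits-near i′∈ j′∈)

  bits-offsets : ∀ d → ∣ d ∣ ≤ 1 → ∃[ i ] ∃[ j ] (i ∈ bits × j ∈ bits × + suc i - + suc j ≡ d)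
  bits-offsets -[1+ 0 ]        _        = 0 , 1 , here refl , there (here refl) , refl
  bits-offsets (+ 0)           _        = 0 , 0 , here refl , here refl , refl
  bits-offsets (+ 1)           _        = 1 , 0 , there (here refl) , here refl , refl
  bits-offsets (+ suc (suc _)) (s≤s ())
  bits-offsets -[1+ suc _ ]    (s≤s ())

  common-offset : ∀ x y → ∣ x - y ∣ ≤ 1 →
    ∃[ a ] ∃[ i ] ∃[ j ] (i ∈ bits × j ∈ bits × x ≡ + suc i + a × y ≡ + suc j + a)
  common-offset x y h =
    let i , j , i∈ , j∈ , eq = bits-offsets (x - y) h
    in x - + suc i , i , j , i∈ , j∈ , restore x (+ suc i) ,
       trans (cancel x y) (trans (cong (x -_) (sym eq)) (reassociate x (+ suc i) (+ suc j)))
    where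
    restore : ∀ x s → x ≡ s + (x - s)
    restore = solve-∀
    cancel : ∀ x y → y ≡ x - (x - y)
    cancel = solve-∀
    reassociate : ∀ x s t → x - (s - t) ≡ t + (x - s)
    reassociate = solve-∀

  adjacent-centres : ∀ u v → InN u v → ∃[ o ] ∃[ z ] ∃[ z′ ]
    (z ∈ innerCorners × z′ ∈ innerCorners × u ≡ at o (centre z) × v ≡ at o (centre z′))
  adjacent-centres (x , y) (x′ , y′) (hx , hy) =
    let a , i , j , i∈ , j∈ , ex , ex′ = common-offset x x′ hx
        b , i′ , j′ , i′∈ , j′∈ , ey , ey′ = common-offset y y′ hy
    in (a , b) , (i , i′) , (j , j′) , ∈-cartesianProduct⁺ i∈ i′∈ , ∈-cartesianProduct⁺ j∈ j′∈ ,
       cong₂ _,_ ex ey , cong₂ _,_ ex′ ey′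

  covered : Window → Cell → Bool
  covered g z = any g (ball z)

  includedI : Window → Cell → Cell → Bool
  includedI g z z′ = all (λ c → not (g c) ∨ near (centre z′) c) (ball z)

  separated : Window → Cell → Cell → Bool
  separated g z z′ =
    g (centre z) ∨ g (centre z′) ∨ not (includedI g z z′ ∧ includedI g z′ z)

  _≟ᶜ_ : (z z′ : Cell) → Dec (z ≡ z′)
  _≟ᶜ_ = ≡-dec ℕ._≟_ ℕ._≟_

  separatedIfDistinct : Window → Cell → Cell → Bool
  separatedIfDistinct g z z′ = does (z ≟ᶜ z′) ∨ separated g z z′

  goodWindow : Window → Bool
  goodWindow g = all (covered g) innerCorners ∧
                 all (λ z → all (separatedIfDistinct g z) innerCorners) innerCorners

  goodWindow-intro : ∀ g → (∀ {z} → z ∈ innerCorners → T (covered g z)) →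
    (∀ {z z′} → z ∈ innerCorners → z′ ∈ innerCorners → z ≢ z′ → T (separated g z z′)) →
    T (goodWindow g)
  goodWindow-intro g cov sep = from T-∧
    ( all⁻ (covered g) (All.tabulate cov)
    , all⁻ (λ z → all (separatedIfDistinct g z) innerCorners) (All.tabulate λ {z} z∈ →
        all⁻ (separatedIfDistinct g z) (All.tabulate λ z′∈ → separated-if-distinct z∈ z′∈)))
    where
    separated-if-distinct : ∀ {z z′} → z ∈ innerCorners → z′ ∈ innerCorners →
      T (separatedIfDistinct g z z′)
    separated-if-distinct {z} {z′} z∈ z′∈ with z ≟ᶜ z′
    ... | yes _   = _
    ... | no z≢z′ = sep z∈ z′∈ z≢z′

  goodWindow-covered : ∀ g {z} → T (goodWindow g) → z ∈ innerCorners → T (covered g z)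
  goodWindow-covered g good = All.lookup (all⁺ (covered g) _ (proj₁ (to T-∧ good)))

  goodWindow-pair : ∀ g {z z′} → T (goodWindow g) → z ∈ innerCorners → z′ ∈ innerCorners →
    T (separatedIfDistinct g z z′)
  goodWindow-pair g {z} good z∈ = All.lookup (all⁺ (separatedIfDistinct g z) _
    (All.lookup (all⁺ (λ z → all (separatedIfDistinct g z) innerCorners) _
      (proj₂ (to (T-∧ {all (covered g) innerCorners}) good))) z∈))

  goodWindow-separated : ∀ g {z z′} → T (goodWindow g) → z ∈ innerCorners → z′ ∈ innerCorners →
    z ≢ z′ → T (separated g z z′)
  goodWindow-separated g {z} {z′} good z∈ z′∈ z≢z′ with z ≟ᶜ z′ | goodWindow-pair g good z∈ z′∈
  ... | yes z≡z′ | _ = ⊥-elim (z≢z′ z≡z′)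
  ... | no _     | h = h

  T-∨-∨-not : ∀ x y a b → T (x ∨ y ∨ not (a ∧ b)) ⇔ (¬ T x → ¬ T y → T a → T b → ⊥)
  T-∨-∨-not true  _     _     _     = mk⇔ (λ _ ¬x → ⊥-elim (¬x _)) _
  T-∨-∨-not false true  _     _     = mk⇔ (λ _ _ ¬y → ⊥-elim (¬y _)) _
  T-∨-∨-not false false true  true  = mk⇔ (λ ()) (λ h → h (λ ()) (λ ()) _ _)
  T-∨-∨-not false false true  false = mk⇔ (λ _ _ _ _ ()) _
  T-∨-∨-not false false false _     = mk⇔ (λ _ _ _ ()) _

  module _ (C : Code) (o : Vertex) where

    covered⇔ : ∀ z → T (covered (window C o) z) ⇔ (∃[ w ] InI C (at o (centre z)) w)
    covered⇔ z = mk⇔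
      (λ h → let c , c∈ , gc = find (any⁻ (window C o) (ball z) h)
             in at o c , to (near⇔InN o (centre z) c) (to (∈ball⇔near z c) c∈) , to T-≡ gc)
      (λ (w , inN , w∈C) → let c , c∈ , w≡ = ball-complete o z w inN
                           in any⁺ (window C o) (lose c∈ (from T-≡ (subst (_∈C C) w≡ w∈C))))

    includedI⇔ : ∀ z z′ → T (includedI (window C o) z z′) ⇔
      (∀ w → InI C (at o (centre z)) w → InI C (at o (centre z′)) w)
    includedI⇔ z z′ = mk⇔ sound complete
      where
      p : Cell → Bool
      p c = not (window C o c) ∨ near (centre z′) c
      sound : T (includedI (window C o) z z′) →
        ∀ w → InI C (at o (centre z)) w → InI C (at o (centre z′)) w
      sound h w (inN , w∈C) with ball-complete o z w inN
      ... | c , c∈ , refl = to (near⇔InN o (centre z′) c)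
        (subst (λ b → T (not b ∨ near (centre z′) c)) w∈C (All.lookup (all⁺ p (ball z) h) c∈)) , w∈C
      complete : (∀ w → InI C (at o (centre z)) w → InI C (at o (centre z′)) w) →
        T (includedI (window C o) z z′)
      complete h = all⁻ p (All.tabulate λ {c} → codeword-near c)
        where
        codeword-near : ∀ c → c ∈ ball z → T (p c)
        codeword-near c c∈ with window C o c in gc
        ... | false = _
        ... | true  = from (near⇔InN o (centre z′) c) (proj₁
          (h (at o c) (to (near⇔InN o (centre z) c) (to (∈ball⇔near z c) c∈) , gc)))

    separated⇔ : ∀ z z′ → let u = at o (centre z); v = at o (centre z′) in
      T (separated (window C o) z z′) ⇔ (¬ u ∈C C → ¬ v ∈C C → ¬ SameI C u v)
    separated⇔ z z′ = mk⇔
      (λ sep ¬u ¬v same → to (T-∨-∨-not _ _ _ _) sep (¬u ∘ to T-≡) (¬v ∘ to T-≡)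
        (from (includedI⇔ z z′) (proj₁ ∘ same)) (from (includedI⇔ z′ z) (proj₂ ∘ same)))
      (λ h → from (T-∨-∨-not _ _ _ _) λ ¬x ¬y a b → h (¬x ∘ from T-≡) (¬y ∘ from T-≡)
        (λ w → to (includedI⇔ z z′) a w , to (includedI⇔ z′ z) b w))

  LocalLD⇔goodWindows : ∀ C → LocalLD C ⇔ (Nonempty C × ∀ o → T (goodWindow (window C o)))
  LocalLD⇔goodWindows C = mk⇔
    (λ (nonempty , cov , ld) → nonempty , λ o → goodWindow-intro (window C o)
      (λ {z} _ → from (covered⇔ C o z) (cov (at o (centre z))))
      (λ z∈ z′∈ z≢z′ → from (separated⇔ C o _ _) (ld _ _ (adjacent o z∈ z′∈ z≢z′))))
    (λ (nonempty , good) → nonempty , covering good , separating good)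
    where
    adjacent : ∀ o {z z′} → z ∈ innerCorners → z′ ∈ innerCorners → z ≢ z′ →
      Adjacent (at o (centre z)) (at o (centre z′))
    adjacent o {z} {z′} z∈ z′∈ z≢z′ =
      to (near⇔InN o (centre z) (centre z′)) (innerCorners-near z∈ z′∈) ,
      z≢z′ ∘ centre-injective ∘ at-injective o
      where
      centre-injective : ∀ {c c′} → centre c ≡ centre c′ → c ≡ c′
      centre-injective refl = refl
    covering : (∀ o → T (goodWindow (window C o))) → Covering C
    covering good (x , y) = subst (λ v → ∃[ w ] InI C v w) (sym (cong₂ _,_ (restore x) (restore y)))
      (to (covered⇔ C o (0 , 0)) (goodWindow-covered (window C o) (good o) (here refl)))
      where
      o = (x - + 1 , y - + 1)
      restore : ∀ x → x ≡ + 1 + (x - + 1)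
      restore = solve-∀
    separating : (∀ o → T (goodWindow (window C o))) →
      ∀ u v → Adjacent u v → ¬ u ∈C C → ¬ v ∈C C → ¬ SameI C u v
    separating good u v (inN , u≢v) with adjacent-centres u v inN
    ... | o , z , z′ , z∈ , z′∈ , refl , refl = to (separated⇔ C o z z′)
      (goodWindow-separated (window C o) (good o) z∈ z′∈ (u≢v ∘ cong (at o ∘ centre)))

  -- goodWindow and weight inspect only the sixteen cells of the window, so they factor
  -- definitionally through contents.
  windowCells : Vec Cell 16
  windowCells = Vec.allPairs (0 ∷ 1 ∷ 2 ∷ 3 ∷ []) (0 ∷ 1 ∷ 2 ∷ 3 ∷ [])

  contents : Window → Subset 16
  contents g = Vec.map g windowCells

  entry : ∀ {n} → Vec Bool n → ℕ → Bool
  entry []       _       = false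
  entry (b ∷ _)  zero    = b
  entry (_ ∷ bs) (suc k) = entry bs k

  fromContents : Subset 16 → Window
  fromContents s (i , j) = entry s (i ℕ.* 4 ℕ.+ j)

  goodWindow-cong : ∀ {g g′} → (∀ c → g c ≡ g′ c) → goodWindow g ≡ goodWindow g′
  goodWindow-cong g≗g′ = cong (goodWindow ∘ fromContents) (Vec.map-cong g≗g′ windowCells)

  indicator : Window → ℕ → ℕ → ℕ
  indicator g i j = if g (i , j) then 1 else 0

  weight : Window → ℕ
  weight g = rectSum (indicator g) 4 4

  -- Exhaustive search; testing the weight first leaves only 137 of the 2^16 fillings to inspect.
  noSparseGoodWindow : ¬ (∃[ s ] (weight (fromContents s) ℕ.< 3 × T (goodWindow (fromContents s))))
  noSparseGoodWindow = toWitnessFalse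
    {a? = anySubset? λ s → weight (fromContents s) ℕ.<? 3 ×-dec T? (goodWindow (fromContents s))} _

  3≤weight : ∀ g → T (goodWindow g) → 3 ≤ weight g
  3≤weight g good = ℕP.≮⇒≥ (λ w<3 → noSparseGoodWindow (contents g , w<3 , good))

module Counting where
  open import Data.Bool using (if_then_else_)
  open import Data.Nat as ℕ using (ℕ; suc; _≤_; _+_; _*_)
  import Data.Nat.Properties as ℕP
  import Data.Nat.Tactic.RingSolver as ℕ
  open import Data.Integer as ℤ using (ℤ; +_)
  import Data.Integer.Properties as ℤP
  import Data.Integer.Tactic.RingSolver as ℤ
  open import Data.Product using (proj₂)
  open import Function using (Equivalence)
  open import Relation.Binary.PropositionalEquality
  open FiniteSums
  open Windows

  count≡rectSum : ∀ C n →
    count C n ≡ rectSum (indicator (window C (ℤ.- + n , ℤ.- + n))) (suc (2 * n)) (suc (2 * n))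
  count≡rectSum C n = trans (sum-map-applyUpTo (suc (2 * n)) (λ k → k) shift _)
    (sumBelow-cong (suc (2 * n)) λ i → sum-map-applyUpTo (suc (2 * n)) (λ k → k) shift
      (λ j → if C (shift i , j) then 1 else 0))
    where
    shift : ℕ → ℤ
    shift k = + k ℤ.- + n

  at-+ : ∀ o i j a b → at o (a + i , b + j) ≡ at (at o (a , b)) (i , j)
  at-+ (x , y) i j a b = cong₂ _,_ (shift x a i) (shift y b j)
    where
    reassociate : ∀ x a i → a ℤ.+ i ℤ.+ x ≡ i ℤ.+ (a ℤ.+ x)
    reassociate = ℤ.solve-∀
    shift : ∀ x a i → + (a + i) ℤ.+ x ≡ + i ℤ.+ (+ a ℤ.+ x)
    shift x a i = trans (cong (ℤ._+ x) (ℤP.pos-+ a i)) (reassociate x (+ a) (+ i))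

  blockSum-window : ∀ C o a b h w →
    blockSum (indicator (window C o)) a b h w ≡ rectSum (indicator (window C (at o (a , b)))) h w
  blockSum-window C o a b h w =
    rectSum-cong h w (λ i j → cong (λ v → if C v then 1 else 0) (at-+ o i j a b))

  m*[m*3]≤count : ∀ C → LocalLD C → ∀ m → m * (m * 3) ≤ count C (2 * m)
  m*[m*3]≤count C localLD m = begin
    m * (m * 3)                 ≤⟨ tiles-≥ G window≥3 m m ⟩
    rectSum G (m * 4) (m * 4)   ≤⟨ rectSum-mono-≤ G 4m≤L 4m≤L ⟩
    rectSum G L L               ≡⟨ count≡rectSum C (2 * m) ⟨
    count C (2 * m)             ∎
    where
    open ℕP.≤-Reasoning
    L = suc (2 * (2 * m))
    o = (ℤ.- + (2 * m) , ℤ.- + (2 * m))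
    G = indicator (window C o)
    window≥3 : ∀ a b → 3 ≤ blockSum G a b 4 4
    window≥3 a b = subst (3 ≤_) (sym (blockSum-window C o a b 4 4))
      (3≤weight (window C o′) (proj₂ (Equivalence.to (LocalLD⇔goodWindows C) localLD) o′))
      where o′ = at o (a , b)
    4m≤L : m * 4 ≤ L
    4m≤L = ℕP.≤-trans (ℕP.≤-reflexive (double m)) (ℕP.n≤1+n _)
      where
      double : ∀ m → m * 4 ≡ 2 * (2 * m)
      double = ℕ.solve-∀

  count-lower-bound : ∀ C → LocalLD C → ∀ m →
    3 * sizeQ (2 * m) ≤ 16 * count C (2 * m) + 24 * suc (2 * m)
  count-lower-bound C localLD m = begin
    3 * sizeQ (2 * m)                        ≤⟨ ℕP.m≤m+n _ (24 * m + 21) ⟩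
    3 * sizeQ (2 * m) + (24 * m + 21)        ≡⟨ expand m ⟩
    16 * (m * (m * 3)) + 24 * suc (2 * m)    ≤⟨ ℕP.+-monoˡ-≤ _ (ℕP.*-monoʳ-≤ 16 (m*[m*3]≤count C localLD m)) ⟩
    16 * count C (2 * m) + 24 * suc (2 * m)  ∎
    where
    open ℕP.≤-Reasoning
    expand : ∀ m → 3 * suc (4 * (2 * m) * (2 * m) + 4 * (2 * m)) + (24 * m + 21) ≡
                   16 * (m * (m * 3)) + 24 * suc (2 * m)
    expand = ℕ.solve-∀

module PeriodicCodes where
  open import Data.Bool using (Bool; T)
  open import Data.Bool.ListAction using (all)
  open import Data.Empty using (⊥-elim)
  open import Data.Nat as ℕ using (ℕ; zero; suc; _<_; NonZero)
  import Data.Nat.Properties as ℕP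
  open import Data.Nat.DivMod using (_%_)
  open import Data.Integer using (+_; _+_; _-_; _*_; _%ℕ_; _/ℕ_; ∣_∣; _⊖_)
  import Data.Integer.Properties as ℤP
  open import Data.Integer.DivMod using (a≡a%ℕn+[a/ℕn]*n; n%ℕd<d)
  open import Data.Integer.Tactic.RingSolver using (solve-∀)
  open import Data.List using (upTo)
  open import Data.List.Membership.Propositional.Properties using (∈-upTo⁺)
  import Data.List.Relation.Unary.All as All
  open import Data.List.Relation.Unary.All.Properties using (all⁺)
  open import Data.Product using (proj₁; proj₂)
  open import Relation.Binary.PropositionalEquality
  open Windows

  multiple-of-d≡0 : ∀ {d x} k → x < d → x ≡ k ℕ.* d → x ≡ 0
  multiple-of-d≡0 zero    _   x≡kd = x≡kd
  multiple-of-d≡0 (suc k) x<d x≡kd = ⊥-elim (ℕP.<⇒≱ x<d (subst (_ ℕ.≤_) (sym x≡kd) (ℕP.m≤m+n _ _)))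

  remainder-unique : ∀ {d r r′} A B → r < d → r′ < d → + r + A * + d ≡ + r′ + B * + d → r ≡ r′
  remainder-unique {d} {r} {r′} A B r<d r′<d eq = ℕP.∣m-n∣≡0⇒m≡n
    (multiple-of-d≡0 ∣ B - A ∣ (ℕP.≤-<-trans (ℕP.∣m-n∣≤m⊔n r r′) (ℕP.⊔-lub r<d r′<d)) distance)
    where
    n′ = + r′ + B * + d
    rearrange : ∀ r r′ A B d → r - r′ ≡ (r + A * d) - (r′ + B * d) + (B - A) * d
    rearrange = solve-∀
    cancel : ∀ t s → t - t + s ≡ s
    cancel = solve-∀
    distance : ℕ.∣ r - r′ ∣ ≡ ∣ B - A ∣ ℕ.* d
    distance = begin
      ℕ.∣ r - r′ ∣                              ≡⟨ ∣m⊖n∣≡∣m-n∣ r r′ ⟨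
      ∣ r ⊖ r′ ∣                                ≡⟨ cong ∣_∣ (ℤP.m-n≡m⊖n r r′) ⟨
      ∣ + r - + r′ ∣                            ≡⟨ cong ∣_∣ (rearrange (+ r) (+ r′) A B (+ d)) ⟩
      ∣ (+ r + A * + d) - n′ + (B - A) * + d ∣  ≡⟨ cong (λ t → ∣ t - n′ + (B - A) * + d ∣) eq ⟩
      ∣ n′ - n′ + (B - A) * + d ∣               ≡⟨ cong ∣_∣ (cancel n′ ((B - A) * + d)) ⟩
      ∣ (B - A) * + d ∣                         ≡⟨ ℤP.abs-* (B - A) (+ d) ⟩
      ∣ B - A ∣ ℕ.* d                           ∎
      where open ≡-Reasoning

  %ℕ-periodic : ∀ x k d .{{_ : NonZero d}} → (x + k * + d) %ℕ d ≡ x %ℕ d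
  %ℕ-periodic x k d = sym (remainder-unique (x /ℕ d + k) (y /ℕ d) (n%ℕd<d x d) (n%ℕd<d y d) (begin
    + (x %ℕ d) + (x /ℕ d + k) * + d      ≡⟨ regroup (+ (x %ℕ d)) (x /ℕ d) k (+ d) ⟩
    (+ (x %ℕ d) + x /ℕ d * + d) + k * + d  ≡⟨ cong (_+ k * + d) (a≡a%ℕn+[a/ℕn]*n x d) ⟨
    y                                      ≡⟨ a≡a%ℕn+[a/ℕn]*n y d ⟩
    + (y %ℕ d) + y /ℕ d * + d              ∎))
    where
    open ≡-Reasoning
    y = x + k * + d
    regroup : ∀ r q k d → r + (q + k) * d ≡ (r + q * d) + k * d
    regroup = solve-∀

  +-%ℕ : ∀ i x d .{{_ : NonZero d}} → (+ i + x) %ℕ d ≡ (i ℕ.+ x %ℕ d) % d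
  +-%ℕ i x d = begin
    (+ i + x) %ℕ d                ≡⟨ cong (λ t → (+ i + t) %ℕ d) (a≡a%ℕn+[a/ℕn]*n x d) ⟩
    (+ i + (+ r + q * + d)) %ℕ d  ≡⟨ cong (_%ℕ d) (ℤP.+-assoc (+ i) (+ r) (q * + d)) ⟨
    (+ i + + r + q * + d) %ℕ d    ≡⟨ cong (λ t → (t + q * + d) %ℕ d) (ℤP.pos-+ i r) ⟨
    (+ (i ℕ.+ r) + q * + d) %ℕ d  ≡⟨ %ℕ-periodic (+ (i ℕ.+ r)) q d ⟩
    (i ℕ.+ r) % d                 ∎
    where
    open ≡-Reasoning
    r = x %ℕ d
    q = x /ℕ d

  periodic : (h w : ℕ) .{{_ : NonZero h}} .{{_ : NonZero w}} → Window → Code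
  periodic h w t (x , y) = t (x %ℕ h , y %ℕ w)

  torusWindow : (h w : ℕ) .{{_ : NonZero h}} .{{_ : NonZero w}} → Window → Cell → Window
  torusWindow h w t (r , s) (i , j) = t ((i ℕ.+ r) % h , (j ℕ.+ s) % w)

  window-periodic : ∀ h w .{{_ : NonZero h}} .{{_ : NonZero w}} t o c →
    window (periodic h w t) o c ≡ torusWindow h w t (proj₁ o %ℕ h , proj₂ o %ℕ w) c
  window-periodic h w t (a , b) (i , j) = cong₂ (λ p q → t (p , q)) (+-%ℕ i a h) (+-%ℕ j b w)

  all-upTo² : ∀ {h w} (P : ℕ → ℕ → Bool) → T (all (λ r → all (P r) (upTo w)) (upTo h)) →
    ∀ {r s} → r < h → s < w → T (P r s)
  all-upTo² {h} {w} P allP {r} r<h s<w = All.lookup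
    (all⁺ (P r) _ (All.lookup (all⁺ (λ r → all (P r) (upTo w)) _ allP) (∈-upTo⁺ r<h)))
    (∈-upTo⁺ s<w)

module TileCode where
  open import Data.Bool using (true; false; T; if_then_else_)
  open import Data.Nat using (suc; _≤_; _+_; _*_; _≡ᵇ_)
  import Data.Nat.Properties as ℕP
  open import Data.Nat.Tactic.RingSolver using (solve-∀)
  open import Data.Integer as ℤ using (+_)
  open import Data.Integer.DivMod using (n%ℕd<d)
  open import Function using (Equivalence)
  open import Relation.Binary.PropositionalEquality
  open FiniteSums
  open Windows
  open Counting
  open PeriodicCodes

  tile : Window
  tile (1 , 2) = true
  tile (1 , 5) = true
  tile (1 , 7) = true
  tile (3 , 1) = true
  tile (3 , 3) = true
  tile (3 , 6) = true
  tile _       = false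

  tileCode : Code
  tileCode = periodic 4 8 tile

  tileCode-LocalLD : LocalLD tileCode
  tileCode-LocalLD = Equivalence.from (LocalLD⇔goodWindows tileCode) (((+ 1 , + 2) , refl) , good)
    where
    good : ∀ o → T (goodWindow (window tileCode o))
    good o@(a , b) = subst T (sym (goodWindow-cong (window-periodic 4 8 tile o)))
      (all-upTo² (λ r s → goodWindow (torusWindow 4 8 tile (r , s))) _ (n%ℕd<d a 4) (n%ℕd<d b 8))

  tileCode-rectangles : ∀ o → rectSum (indicator (window tileCode o)) 4 8 ≡ 6
  tileCode-rectangles o@(a , b) = trans
    (rectSum-cong 4 8 λ i j → cong (λ v → if v then 1 else 0) (window-periodic 4 8 tile o (i , j)))
    (ℕP.≡ᵇ⇒≡ _ 6 (all-upTo² (λ r s → rectSum (indicator (torusWindow 4 8 tile (r , s))) 4 8 ≡ᵇ 6) _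
      (n%ℕd<d a 4) (n%ℕd<d b 8)))

  count-upper-bound : ∀ n → 16 * count tileCode n ≤ 3 * sizeQ n + 93 * suc n
  count-upper-bound n =
    let m , L≤4m , 4m≤L+3 = covering-multiple L 3
        k , L≤8k , 8k≤L+7 = covering-multiple L 7
    in begin
      16 * count tileCode n             ≡⟨ cong (16 *_) (count≡rectSum tileCode n) ⟩
      16 * rectSum G L L                ≤⟨ ℕP.*-monoʳ-≤ 16 (rectSum-mono-≤ G L≤4m L≤8k) ⟩
      16 * rectSum G (m * 4) (k * 8)    ≤⟨ ℕP.*-monoʳ-≤ 16 (tiles-≤ G rectangle≤6 m k) ⟩
      16 * (m * (k * 6))                ≡⟨ regroup m k ⟩
      3 * (m * 4 * (k * 8))             ≤⟨ ℕP.*-monoʳ-≤ 3 (ℕP.*-mono-≤ 4m≤L+3 8k≤L+7) ⟩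
      3 * ((L + 3) * (L + 7))           ≤⟨ ℕP.m≤m+n _ (33 * n) ⟩
      3 * ((L + 3) * (L + 7)) + 33 * n  ≡⟨ expand n ⟩
      3 * sizeQ n + 93 * suc n          ∎
    where
    open ℕP.≤-Reasoning
    L = suc (2 * n)
    o = (ℤ.- + n , ℤ.- + n)
    G = indicator (window tileCode o)
    rectangle≤6 : ∀ a b → blockSum G a b 4 8 ≤ 6
    rectangle≤6 a b = ℕP.≤-reflexive
      (trans (blockSum-window tileCode o a b 4 8) (tileCode-rectangles (at o (a , b))))
    regroup : ∀ m k → 16 * (m * (k * 6)) ≡ 3 * (m * 4 * (k * 8))
    regroup = solve-∀
    expand : ∀ n → 3 * ((suc (2 * n) + 3) * (suc (2 * n) + 7)) + 33 * n ≡
                   3 * suc (4 * n * n + 4 * n) + 93 * suc n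
    expand = solve-∀

module Density where
  open import Data.Nat using (suc; _≤_; _<_; _+_; _*_)
  import Data.Nat.Properties as ℕP
  open import Data.Nat.Tactic.RingSolver using (solve-∀)
  open import Data.Integer as ℤ using (+_)
  import Data.Integer.Properties as ℤP
  open import Data.Rational as ℚ using (ℚ; mkℚ; _/_)
  import Data.Rational.Properties as ℚP
  open import Data.Rational.Unnormalised as ℚᵘ using (mkℚᵘ; *<*)
  import Data.Rational.Unnormalised.Properties as ℚᵘP
  open import Relation.Binary.PropositionalEquality

  pos-cross-< : ∀ x y z w u v t → x * y < (z * w + u * v) * t →
    + x ℤ.* + y ℤ.< (+ z ℤ.* + w ℤ.+ + u ℤ.* + v) ℤ.* + t
  pos-cross-< x y z w u v t h = subst₂ ℤ._<_ (ℤP.pos-* x y)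
    (trans (ℤP.pos-* (z * w + u * v) t)
      (cong (ℤ._* + t) (trans (ℤP.pos-+ (z * w) (u * v)) (cong₂ ℤ._+_ (ℤP.pos-* z w) (ℤP.pos-* u v)))))
    (ℤ.+<+ h)

  fraction<fraction+ε : ∀ {c K a b p d} (ε : ℚ) → ℚ.toℚᵘ ε ≡ mkℚᵘ (+ suc p) d →
    c * (suc b * suc d) < (a * suc d + suc p * suc b) * suc K →
    (+ c) / suc K ℚ.< (+ a) / suc b ℚ.+ ε
  fraction<fraction+ε {c} {K} {a} {b} {p} ε ε≡ h = ℚP.toℚᵘ-cancel-<
    (ℚᵘP.<-respˡ-≃ (ℚᵘP.≃-sym (ℚP.toℚᵘ-fromℚᵘ (mkℚᵘ (+ c) K)))
      (ℚᵘP.<-respʳ-≃ (ℚᵘP.≃-sym (ℚᵘP.≃-trans (ℚP.toℚᵘ-homo-+ ((+ a) / suc b) ε)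
                                  (ℚᵘP.+-cong (ℚP.toℚᵘ-fromℚᵘ (mkℚᵘ (+ a) b)) (ℚᵘP.≃-reflexive ε≡))))
        (*<* (pos-cross-< c _ a _ (suc p) _ (suc K) h))))

  <-+⇒-< : ∀ {p q} r → p ℚ.< q ℚ.+ r → p ℚ.- r ℚ.< q
  <-+⇒-< {p} {q} r p<q+r = subst (p ℚ.- r ℚ.<_) q+r-r≡q (ℚP.+-monoˡ-< (ℚ.- r) p<q+r)
    where
    q+r-r≡q : q ℚ.+ r ℚ.- r ≡ q
    q+r-r≡q = trans (ℚP.+-assoc q r (ℚ.- r))
      (trans (cong (q ℚ.+_) (ℚP.+-inverseʳ r)) (ℚP.+-identityʳ q))

  sizeQ-square : ∀ n → suc n * suc n ≤ sizeQ n
  sizeQ-square n = subst (suc n * suc n ≤_) (sym (expand n)) (ℕP.m≤m+n _ _)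
    where
    expand : ∀ n → suc (4 * n * n + 4 * n) ≡ suc n * suc n + (3 * n * n + 2 * n)
    expand = solve-∀

  error<sizeQ : ∀ B d n → B * suc d ≤ n → B * suc n * suc d < sizeQ n
  error<sizeQ B d n Bd≤n = begin-strict
    B * suc n * suc d  ≡⟨ swap B (suc n) (suc d) ⟩
    B * suc d * suc n  ≤⟨ ℕP.*-monoˡ-≤ (suc n) Bd≤n ⟩
    n * suc n          <⟨ ℕP.*-monoˡ-< (suc n) (ℕP.n<1+n n) ⟩
    suc n * suc n      ≤⟨ sizeQ-square n ⟩
    sizeQ n            ∎
    where
    open ℕP.≤-Reasoning
    swap : ∀ B m d → B * m * d ≡ B * d * m
    swap = solve-∀

  -- The error term B (n + 1) is o(|Q_n|), so it is absorbed by any ε > 0 once n ≥ B / ε.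
  densityLe : ∀ C a b B → (∀ n → suc b * count C n ≤ a * sizeQ n + B * suc n) →
    DensityLe C ((+ a) / suc b)
  densityLe C a b B bound ε@(mkℚ (+ suc p) d _) _ = B * suc d , λ n Bd≤n →
    fraction<fraction+ε {count C n} {4 * n * n + 4 * n} {a} {b} {p} ε refl
      (cross-multiplied n (count C n) (bound n) Bd≤n)
    where
    cross-multiplied : ∀ n c → suc b * c ≤ a * sizeQ n + B * suc n → B * suc d ≤ n →
      c * (suc b * suc d) < (a * suc d + suc p * suc b) * sizeQ n
    cross-multiplied n c bc≤ Bd≤n = begin-strict
      c * (suc b * suc d)                ≡⟨ e₁ c (suc b) (suc d) ⟩
      suc b * c * suc d                  ≤⟨ ℕP.*-monoˡ-≤ (suc d) bc≤ ⟩
      (a * S + B * suc n) * suc d        ≡⟨ e₂ a S B (suc n) (suc d) ⟩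
      a * suc d * S + B * suc n * suc d  <⟨ ℕP.+-monoʳ-< (a * suc d * S) (error<sizeQ B d n Bd≤n) ⟩
      a * suc d * S + S                  ≤⟨ ℕP.+-monoʳ-≤ (a * suc d * S) (ℕP.m≤n*m S (suc p * suc b)) ⟩
      a * suc d * S + suc p * suc b * S  ≡⟨ e₃ a (suc d) (suc p * suc b) S ⟩
      (a * suc d + suc p * suc b) * S    ∎
      where
      open ℕP.≤-Reasoning
      S = sizeQ n
      e₁ : ∀ c b d → c * (b * d) ≡ b * c * d
      e₁ = solve-∀
      e₂ : ∀ a S B m d → (a * S + B * m) * d ≡ a * d * S + B * m * d
      e₂ = solve-∀
      e₃ : ∀ a d q S → a * d * S + q * S ≡ (a * d + q) * S
      e₃ = solve-∀

  densityGe : ∀ C a b B → (∀ N → ∃[ n ] (N ≤ n × a * sizeQ n ≤ suc b * count C n + B * suc n)) →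
    DensityGe C ((+ a) / suc b)
  densityGe C a b B bound ε@(mkℚ (+ suc p) d _) _ N =
    let n , N+Bd≤n , a≤ = bound (N + B * suc d)
    in n , ℕP.≤-trans (ℕP.m≤m+n N _) N+Bd≤n ,
       <-+⇒-< ε (fraction<fraction+ε {a} {b} {count C n} {4 * n * n + 4 * n} {p} ε refl
         (cross-multiplied n (count C n) a≤ (ℕP.m+n≤o⇒n≤o N N+Bd≤n)))
    where
    cross-multiplied : ∀ n c → a * sizeQ n ≤ suc b * c + B * suc n → B * suc d ≤ n →
      a * (sizeQ n * suc d) < (c * suc d + suc p * sizeQ n) * suc b
    cross-multiplied n c a≤ Bd≤n = begin-strict
      a * (S * suc d)                        ≡⟨ ℕP.*-assoc a S (suc d) ⟨
      a * S * suc d                          ≤⟨ ℕP.*-monoˡ-≤ (suc d) a≤ ⟩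
      (suc b * c + B * suc n) * suc d        ≡⟨ e₁ (suc b) c B (suc n) (suc d) ⟩
      c * suc d * suc b + B * suc n * suc d  <⟨ ℕP.+-monoʳ-< (c * suc d * suc b) (error<sizeQ B d n Bd≤n) ⟩
      c * suc d * suc b + S                  ≤⟨ ℕP.+-monoʳ-≤ (c * suc d * suc b) (ℕP.m≤n*m S (suc p * suc b)) ⟩
      c * suc d * suc b + suc p * suc b * S  ≡⟨ e₂ c (suc d) (suc b) (suc p) S ⟩
      (c * suc d + suc p * S) * suc b        ∎
      where
      open ℕP.≤-Reasoning
      S = sizeQ n
      e₁ : ∀ b c B m d → (b * c + B * m) * d ≡ c * d * b + B * m * d
      e₁ = solve-∀
      e₂ : ∀ c d b p S → c * d * b + p * b * S ≡ (c * d + p * S) * b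
      e₂ = solve-∀

open import Data.Nat using (_*_)
open import Data.Nat.Properties using (m≤n*m)
open import Data.Integer using (+_)
open import Data.Rational using (_/_)
open Counting using (count-lower-bound)
open TileCode using (tileCode; tileCode-LocalLD; count-upper-bound)
open Density using (densityLe; densityGe)

mainTheorem19 : (∃[ C ] (LocalLD C × DensityLe C ((+ 3) / 16)))
                × (∀ C → LocalLD C → DensityGe C ((+ 3) / 16))
mainTheorem19 =
  (tileCode , tileCode-LocalLD , densityLe tileCode 3 15 93 count-upper-bound) ,
  λ C localLD → densityGe C 3 15 24 λ N → 2 * N , m≤n*m N 2 , count-lower-bound C localLD N
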